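{- Let $T$ be a weighted binary tree and let $T'$ be any element of $\beta(T)$. Then $c(T)\ge c(T')$, with equality if and only if $\beta(T)=\{T\}$.
   Context: Let $T$ be a binary tree, identified with its set of nodes. For $x\in T$, $l(x)$ and $r(x)$ denote the left and right children of $x$, $\pi(x)$ its parent, and $\sigma(x)$ its sibling. $\emptyset$ denotes an absent node. $T$ is weighted if there is $p:T\to\mathbb{R}$ with $\sum_{x\in T}p(x)=1$. Depth is defined by $d(\emptyset)=0$ and $d(x)=1+d(\pi(x))$, and the cost is $c(T)=\sum_{x\in T}d(x)p(x)$. $\overline{p}(x)$ is the sum of $p$ over the subtree rooted at $x$, with $\overline{p}(\emptyset)=0$. For a non-root $x$, $\lambda(x)=l(x)$ if $x$ is a left child and $\lambda(x)=r(x)$ if $x$ is a right child. Right rotation at a node $a$ with left child $b$: with $c,d$ the subtrees of $b$ and $e$ the right subtree of $a$, the node $b$ replaces $a$, keeps left subtree $c$, and gets right child $a$; $a$ has left subtree $d$ and right subtree $e$. Left rotation is the mirror image. Bumping a non-root node $x$ gives $T^x$, the right rotation at $\pi(x)$ if $x$ is a left child and the left rotation at $\pi(x)$ if $x$ is a right child. The merit of bumping a non-root $x$ is $\mu(x,T)=p(x)+\overline{p}(\lambda(x))-p(\pi(x))-\overline{p}(\sigma(x))$. The result of bumping $T$ is the set $\beta(T)$ defined as follows. If $\mu(x,T)\le 0$ for all non-root $x$, then $\beta(T)=\{T\}$. Otherwise $\beta(T)=\{T^x : \mu(x,T)\text{ is maximal}\}$, where the maximum is taken over non-root $x$.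
   Formalization: The weight function p of a weighted binary tree takes values in ℚ instead of ℝ. -}

module Defs where

open import Data.Nat using (ℕ; suc)
open import Data.Integer using (+_)
open import Data.Rational using (ℚ; _+_; _-_; _*_; _≤_; _/_; 0ℚ)
open import Data.List using (List; []; _∷_; _∷ʳ_)
open import Data.Product using (Σ; _×_; _,_)
open import Data.Sum using (_⊎_)
open import Relation.Nullary using (¬_)
open import Relation.Binary.PropositionalEquality using (_≡_)

-- A binary tree with a rational weight at every node; `leaf` is the absent node ∅.
data Tree : Set where
  leaf : Tree
  node : Tree → ℚ → Tree → Tree

data Dir : Set where
  L R : Dir

flip : Dir → Dir
flip L = R
flip R = L

Path : Set
Path = List Dir

child : Dir → Tree → Tree
child _ leaf = leaf
child L (node l _ _) = l
child R (node _ _ r) = r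

-- subtree rooted at a position (leaf = ∅ if the position is absent)
subtreeAt : Path → Tree → Tree
subtreeAt [] t = t
subtreeAt (d ∷ ds) t = subtreeAt ds (child d t)

data IsNode : Tree → Set where
  isNode : ∀ {l w r} → IsNode (node l w r)

psum : Tree → ℚ
psum leaf = 0ℚ
psum (node l w r) = psum l + w + psum r

-- p(x) for a position x (only used at positions carrying a node)
p : Path → Tree → ℚ
p x T with subtreeAt x T
... | leaf = 0ℚ
... | node _ w _ = w

pbar : Path → Tree → ℚ
pbar x T = psum (subtreeAt x T)

Weighted : Tree → Set
Weighted T = psum T ≡ (+ 1 / 1)

-- cost: c(T) = Σ d(x) p(x), root at depth 1
costFrom : ℕ → Tree → ℚ
costFrom d leaf = 0ℚ
costFrom d (node l w r) = ((+ d / 1) * w + costFrom (suc d) l) + costFrom (suc d) r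

cost : Tree → ℚ
cost T = costFrom 1 T

-- A non-root node x is given as (q , δ): q = π(x) and x = q ∷ʳ δ.
NonRoot : Tree → Path → Dir → Set
NonRoot T q δ = IsNode (subtreeAt (q ∷ʳ δ) T)

-- merit μ(x,T) = p(x) + p̄(λ(x)) − p(π(x)) − p̄(σ(x)), x = q ∷ʳ δ
merit : Tree → Path → Dir → ℚ
merit T q δ =
  ((p (q ∷ʳ δ) T + pbar ((q ∷ʳ δ) ∷ʳ δ) T) - p q T) - pbar (q ∷ʳ flip δ) T

-- rotations (identity on shapes where they are undefined)
rotateRight : Tree → Tree
rotateRight (node (node c b d) a e) = node c b (node d a e)
rotateRight t = t

rotateLeft : Tree → Tree
rotateLeft (node c a (node d b e)) = node (node c a d) b e
rotateLeft t = t

modifyAt : Path → (Tree → Tree) → Tree → Tree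
modifyAt [] f t = f t
modifyAt (_ ∷ _) f leaf = leaf
modifyAt (L ∷ ds) f (node l w r) = node (modifyAt ds f l) w r
modifyAt (R ∷ ds) f (node l w r) = node l w (modifyAt ds f r)

rotateTowards : Dir → Tree → Tree
rotateTowards L = rotateRight
rotateTowards R = rotateLeft

-- T^x: bumping x = q ∷ʳ δ (rotation at π(x) = q)
bump : Tree → Path → Dir → Tree
bump T q δ = modifyAt q (rotateTowards δ) T

AllMeritsNonPos : Tree → Set
AllMeritsNonPos T = ∀ q δ → NonRoot T q δ → merit T q δ ≤ 0ℚ

InBeta : Tree → Tree → Set
InBeta T T' =
  (AllMeritsNonPos T × T' ≡ T)
  ⊎ (¬ AllMeritsNonPos T ×
     Σ Path λ q → Σ Dir λ δ → NonRoot T q δ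
       × (∀ q' δ' → NonRoot T q' δ' → merit T q' δ' ≤ merit T q δ)
       × T' ≡ bump T q δ)

BetaIsSingletonSelf : Tree → Set
BetaIsSingletonSelf T = ∀ U → (InBeta T U → U ≡ T) × (U ≡ T → InBeta T U)

{-# OPTIONS --safe #-}
module Submission where

-- Bumping x is a rotation at π(x): x and the subtree λ(x) rise one level, π(x)
-- and the subtree σ(x) sink one level, and every other node keeps its depth.
-- Hence c(T) = c(T^x) + μ(x,T) for arbitrary weights.  If some merit is positive, every element of β(T) is a bump of
-- maximal, hence positive, merit and is strictly cheaper than T; otherwise
-- β(T) = {T}.

open import Defs
open import Data.Nat using (suc)
open import Data.Integer as ℤ using (+_)
import Data.Integer.Properties as ℤ
open import Data.Rational using (ℚ; mkℚ; 0ℚ; 1ℚ; _+_; _-_; _*_; _/_; _≤_; _<_; _≤?_)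
open import Data.Rational.Properties
  using (+-*-commutativeRing; _≟_; normalize-coprime; /-cong; ≤-refl; ≤-trans; <⇒≤; <-irrefl; ≰⇒>; +-monoʳ-<; +-identityʳ; +-assoc)
import Data.Nat.Coprimality as Coprimality
open import Data.List using ([]; _∷_; _∷ʳ_)
open import Relation.Nullary.Decidable using (dec⇒maybe)
open import Data.Product using (_×_; _,_; proj₁)
open import Data.Sum using (inj₁; inj₂)
open import Data.Empty using (⊥-elim)
open import Relation.Nullary using (¬_; yes; no)
open import Relation.Binary.PropositionalEquality
  using (_≡_; refl; sym; cong; subst; subst₂; module ≡-Reasoning)
open import Level using (0ℓ)
open import Tactic.RingSolver using (solve-∀)
open import Tactic.RingSolver.Core.AlmostCommutativeRing using (AlmostCommutativeRing; fromCommutativeRing)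

open ≡-Reasoning

ℚ-ring : AlmostCommutativeRing 0ℓ 0ℓ
ℚ-ring = fromCommutativeRing +-*-commutativeRing (λ x → dec⇒maybe (0ℚ ≟ x))

[1+n]/1≡1+n/1 : ∀ n → + suc n / 1 ≡ 1ℚ + + n / 1
[1+n]/1≡1+n/1 n = begin
  + suc n / 1                         ≡⟨ /-cong (cong (ℤ._+_ (+ 1)) (sym (ℤ.*-identityʳ (+ n)))) refl ⟩
  (+ 1 ℤ.* + 1 ℤ.+ + n ℤ.* + 1) / 1  ≡⟨⟩
  1ℚ + mkℚ (+ n) 0 n⊥1                ≡⟨ cong (λ q → 1ℚ + q) (sym (normalize-coprime n⊥1)) ⟩
  1ℚ + + n / 1                        ∎
  where n⊥1 = Coprimality.sym (Coprimality.1-coprimeTo n)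

subtreeAt-∷ʳ : ∀ xs δ t → subtreeAt (xs ∷ʳ δ) t ≡ child δ (subtreeAt xs t)
subtreeAt-∷ʳ []       δ t = refl
subtreeAt-∷ʳ (x ∷ xs) δ t = subtreeAt-∷ʳ xs δ (child x t)

subtreeAt-leaf : ∀ xs → subtreeAt xs leaf ≡ leaf
subtreeAt-leaf []       = refl
subtreeAt-leaf (L ∷ xs) = subtreeAt-leaf xs
subtreeAt-leaf (R ∷ xs) = subtreeAt-leaf xs

IsNode-child⇒IsNode : ∀ δ t → IsNode (child δ t) → IsNode t
IsNode-child⇒IsNode δ (node _ _ _) _ = isNode

rootWeight : Tree → ℚ
rootWeight leaf         = 0ℚ
rootWeight (node _ w _) = w

p≡rootWeight : ∀ x T → p x T ≡ rootWeight (subtreeAt x T)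
p≡rootWeight x T with subtreeAt x T
... | leaf       = refl
... | node _ _ _ = refl

childMerit : Tree → Dir → ℚ
childMerit s δ =
  ((rootWeight (child δ s) + psum (child δ (child δ s))) - rootWeight s) - psum (child (flip δ) s)

merit≡childMerit : ∀ T q δ → merit T q δ ≡ childMerit (subtreeAt q T) δ
merit≡childMerit T q δ
  rewrite p≡rootWeight (q ∷ʳ δ) T | p≡rootWeight q T
        | subtreeAt-∷ʳ (q ∷ʳ δ) δ T | subtreeAt-∷ʳ q δ T | subtreeAt-∷ʳ q (flip δ) T = refl

costFrom-suc : ∀ d t → costFrom (suc d) t ≡ costFrom d t + psum t
costFrom-suc d leaf         = refl
costFrom-suc d (node l w r)
  rewrite [1+n]/1≡1+n/1 d | costFrom-suc (suc d) l | costFrom-suc (suc d) r =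
  identity (+ d / 1) w (costFrom (suc d) l) (psum l) (costFrom (suc d) r) (psum r)
  where
  identity : ∀ D w A a B b → ((1ℚ + D) * w + (A + a)) + (B + b) ≡ ((D * w + A) + B) + ((a + w) + b)
  identity = solve-∀ ℚ-ring

costFrom-rotateTowards : ∀ s δ → IsNode (child δ s) → ∀ d →
  costFrom d s ≡ costFrom d (rotateTowards δ s) + childMerit s δ
costFrom-rotateTowards (node (node c b e) a f) L isNode d
  rewrite [1+n]/1≡1+n/1 d | costFrom-suc (suc d) c | costFrom-suc (suc d) e | costFrom-suc (suc d) f =
  identity (+ d / 1) a b (costFrom (suc d) c) (psum c) (costFrom (suc d) e) (psum e) (costFrom (suc d) f) (psum f)
  where
  identity : ∀ D wa wb C pc E pe F pf →
    (D * wa + (((1ℚ + D) * wb + (C + pc)) + (E + pe))) + F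
      ≡ ((D * wb + C) + (((1ℚ + D) * wa + (E + pe)) + (F + pf))) + (((wb + pc) - wa) - pf)
  identity = solve-∀ ℚ-ring
costFrom-rotateTowards (node c a (node e b f)) R isNode d
  rewrite [1+n]/1≡1+n/1 d | costFrom-suc (suc d) c | costFrom-suc (suc d) e | costFrom-suc (suc d) f =
  identity (+ d / 1) a b (costFrom (suc d) c) (psum c) (costFrom (suc d) e) (psum e) (costFrom (suc d) f) (psum f)
  where
  identity : ∀ D wa wb C pc E pe F pf →
    (D * wa + C) + (((1ℚ + D) * wb + (E + pe)) + (F + pf))
      ≡ ((D * wb + (((1ℚ + D) * wa + (C + pc)) + (E + pe))) + F) + (((wb + pf) - wa) - pc)
  identity = solve-∀ ℚ-ring

costFrom-modifyAt : ∀ q f m T → IsNode (subtreeAt q T) →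
  (∀ d → costFrom d (subtreeAt q T) ≡ costFrom d (f (subtreeAt q T)) + m) →
  ∀ d → costFrom d T ≡ costFrom d (modifyAt q f T) + m
costFrom-modifyAt [] f m T _ local d = local d
costFrom-modifyAt (_ ∷ q) f m leaf x∈T _ _ with subst IsNode (subtreeAt-leaf q) x∈T
... | ()
costFrom-modifyAt (L ∷ q) f m (node l w r) x∈T local d
  rewrite costFrom-modifyAt q f m l x∈T local (suc d) =
  identity (+ d / 1 * w) (costFrom (suc d) (modifyAt q f l)) (costFrom (suc d) r) m
  where
  identity : ∀ x y z m → (x + (y + m)) + z ≡ ((x + y) + z) + m
  identity = solve-∀ ℚ-ring
costFrom-modifyAt (R ∷ q) f m (node l w r) x∈T local d
  rewrite costFrom-modifyAt q f m r x∈T local (suc d) =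
  sym (+-assoc (+ d / 1 * w + costFrom (suc d) l) (costFrom (suc d) (modifyAt q f r)) m)

cost-bump : ∀ T q δ → NonRoot T q δ → cost T ≡ cost (bump T q δ) + merit T q δ
cost-bump T q δ x∈T rewrite merit≡childMerit T q δ =
  costFrom-modifyAt q (rotateTowards δ) (childMerit π[x] δ) T
    (IsNode-child⇒IsNode δ π[x] x∈π[x]) (costFrom-rotateTowards π[x] δ x∈π[x]) 1
  where
  π[x] : Tree
  π[x] = subtreeAt q T
  x∈π[x] : IsNode (child δ π[x])
  x∈π[x] = subst IsNode (subtreeAt-∷ʳ q δ T) x∈T

cost-bump-< : ∀ T q δ → NonRoot T q δ → 0ℚ < merit T q δ → cost (bump T q δ) < cost T
cost-bump-< T q δ x∈T μ>0 =
  subst₂ _<_ (+-identityʳ (cost (bump T q δ))) (sym (cost-bump T q δ x∈T)) (+-monoʳ-< (cost (bump T q δ)) μ>0)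

maximal-merit-positive : ∀ T q δ → ¬ AllMeritsNonPos T →
  (∀ q′ δ′ → NonRoot T q′ δ′ → merit T q′ δ′ ≤ merit T q δ) → 0ℚ < merit T q δ
maximal-merit-positive T q δ ¬nonpos maximal with merit T q δ ≤? 0ℚ
... | yes μ≤0 = ⊥-elim (¬nonpos (λ q′ δ′ y∈T → ≤-trans (maximal q′ δ′ y∈T) μ≤0))
... | no  μ≰0 = ≰⇒> μ≰0

AllMeritsNonPos⇒BetaIsSingletonSelf : ∀ {T} → AllMeritsNonPos T → BetaIsSingletonSelf T
AllMeritsNonPos⇒BetaIsSingletonSelf {T} nonpos U = U∈β⇒U≡T , λ U≡T → inj₁ (nonpos , U≡T)
  where
  U∈β⇒U≡T : InBeta T U → U ≡ T
  U∈β⇒U≡T (inj₁ (_ , U≡T))    = U≡T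
  U∈β⇒U≡T (inj₂ (¬nonpos , _)) = ⊥-elim (¬nonpos nonpos)

mainTheorem2 : (T : Tree) → Weighted T → (T' : Tree) → InBeta T T' →
    (cost T' ≤ cost T)
      × ((cost T ≡ cost T' → BetaIsSingletonSelf T)
         × (BetaIsSingletonSelf T → cost T ≡ cost T'))
mainTheorem2 T _ T (inj₁ (nonpos , refl)) =
  ≤-refl , (λ _ → AllMeritsNonPos⇒BetaIsSingletonSelf nonpos) , (λ _ → refl)
mainTheorem2 T _ T' T'∈β@(inj₂ (¬nonpos , q , δ , x∈T , maximal , refl)) =
  <⇒≤ cheaper , (λ c≡c′ → ⊥-elim (<-irrefl (sym c≡c′) cheaper)) , λ single → cong cost (sym (proj₁ (single T') T'∈β))
  where
  cheaper : cost T' < cost T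
  cheaper = cost-bump-< T q δ x∈T (maximal-merit-positive T q δ ¬nonpos maximal)
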